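{- Let $G$ be a loop directed graph with vertex set $V$ and let $B_G=(V,V',E)$ be its associated bipartite graph. Let $i_1,\dots,i_t\in V$ and $j_1,\dots,j_t\in V'$. Then $V\setminus\{i_1,\dots,i_t\}$ is a zero forcing set of $G$ with chronological list of forces $j_1\to i_1,\ j_2\to i_2,\ \dots,\ j_t\to i_t$ if and only if $\mathcal{M}=\{\{i_1,j_1\},\dots,\{i_t,j_t\}\}$ is a constrained matching in $B_G$ whose indexing satisfies $\{i_k,j_l\}\notin E$ for all $1\le l<k\le t$.
   Context: A loop directed graph is a finite directed graph in which loops are allowed. The bipartite graph $B_G=(V,V',E)$ associated with $G$ has two copies $V$ and $V'$ of the vertex set of $G$ (a vertex $v$ of $G$ appears as $i_v\in V$ and $j_v\in V'$), and $\{i_s,j_t\}\in E$ iff there is a directed edge from vertex $t$ to vertex $s$ in $G$; in the forces $j_k\to i_k$ the elements of $V,V'$ are identified with the corresponding vertices of $G$. A $t$-matching is a set of $t$ pairwise disjoint edges; it is constrained if no other $t$-matching has the same set of matched vertices. Color change rule in a loop directed graph: each vertex is black or white; if exactly one out-neighbor $j$ of vertex $i$ is white (possibly $j=i$; $i$ need not be black), then $j$ is turned black, and we say $i$ forces $j$, written $i\to j$. A zero forcing set is a set $S$ such that starting with exactly $S$ black and applying the rule repeatedly, all vertices become black; a chronological list of forces is a list of the forces in the order in which they are performed to turn all vertices black. -}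

module Defs where

open import Data.Nat using (ℕ)
open import Data.Fin using (Fin; _<_)
open import Data.Bool using (Bool; true)
open import Data.List using (List; []; _∷_; tabulate)
open import Data.Product using (_×_; _,_; ∃-syntax)
open import Data.Sum using (_⊎_)
open import Relation.Binary.PropositionalEquality using (_≡_; _≢_)
open import Relation.Nullary using (¬_)
open import Function.Definitions using (Injective)
open import Function.Bundles using (_⇔_)

-- A loop directed graph on vertex set Fin n: adjacency G u v = true iff
-- there is a directed edge u → v (loops u → u allowed).
LoopDigraph : ℕ → Set
LoopDigraph n = Fin n → Fin n → Bool

Arc : ∀ {n} → LoopDigraph n → Fin n → Fin n → Set
Arc G u v = G u v ≡ true

-- Associated bipartite graph B_G = (V, V', E): both V and V' are copies of
-- Fin n; BEdge G s t means {i_s, j_t} ∈ E, i.e. there is an edge t → s in G.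
BEdge : ∀ {n} → LoopDigraph n → Fin n → Fin n → Set
BEdge G s t = Arc G t s

Black : ℕ → Set₁
Black n = Fin n → Set

addBlack : ∀ {n} → Black n → Fin n → Black n
addBlack B v w = B w ⊎ w ≡ v

-- Colour change rule: u forces v (given black set B) iff v is the unique
-- white out-neighbour of u (u itself need not be black; v = u allowed).
Forces : ∀ {n} → LoopDigraph n → Black n → Fin n → Fin n → Set
Forces G B u v = ¬ B v × Arc G u v × (∀ w → Arc G u w → ¬ B w → w ≡ v)

ChronList : ∀ {n} → LoopDigraph n → Black n → List (Fin n × Fin n) → Set
ChronList G B [] = ∀ w → B w
ChronList G B ((u , v) ∷ fs) = Forces G B u v × ChronList G (addBlack B v) fs

IsZFSWithChronList : ∀ {n} → LoopDigraph n → Black n → List (Fin n × Fin n) → Set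
IsZFSWithChronList G S fs = ChronList G S fs

complementOf : ∀ {n t} → (Fin t → Fin n) → Black n
complementOf i v = ∀ k → v ≢ i k

forceList : ∀ {n t} → (Fin t → Fin n) → (Fin t → Fin n) → List (Fin n × Fin n)
forceList i j = tabulate (λ k → (j k , i k))

IsMatching : ∀ {n} → LoopDigraph n → (t : ℕ) → (Fin t → Fin n) → (Fin t → Fin n) → Set
IsMatching G t i j = (∀ k → BEdge G (i k) (j k)) × Injective _≡_ _≡_ i × Injective _≡_ _≡_ j

SameMatchedVertices : ∀ {n t} → (i j i' j' : Fin t → Fin n) → Set
SameMatchedVertices i j i' j' =
  (∀ v → (∃[ k ] i k ≡ v) ⇔ (∃[ k ] i' k ≡ v)) ×
  (∀ v → (∃[ k ] j k ≡ v) ⇔ (∃[ k ] j' k ≡ v))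

SameEdges : ∀ {n t} → (i j i' j' : Fin t → Fin n) → Set
SameEdges i j i' j' =
  (∀ k → ∃[ l ] (i k ≡ i' l × j k ≡ j' l)) ×
  (∀ l → ∃[ k ] (i k ≡ i' l × j k ≡ j' l))

-- constrained t-matching: no other t-matching has the same matched vertices
IsConstrainedMatching : ∀ {n : ℕ} → LoopDigraph n → (t : ℕ) → (Fin t → Fin n) → (Fin t → Fin n) → Set
IsConstrainedMatching {n} G t i j =
  IsMatching G t i j ×
  (∀ (i' j' : Fin t → Fin n) → IsMatching G t i' j' →
     SameMatchedVertices i j i' j' → SameEdges i j i' j')

OrderCondition : ∀ {n} → LoopDigraph n → (t : ℕ) → (Fin t → Fin n) → (Fin t → Fin n) → Set
OrderCondition G t i j = ∀ (k l : Fin t) → l < k → ¬ BEdge G (i k) (j l)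

-- Just before the k-th force the black vertices are V ∖ {i_k, …, i_t}.  So
-- j_k → i_k is a valid force exactly when {i_k, j_k} is an edge, i_k differs
-- from the earlier i_m, and j_k is adjacent to no later i_m: the order
-- condition.  Edges with distinct i_k and the order condition already make
-- the j_k distinct, and they make the matching constrained: in a matching on
-- the same vertices, j_k is matched to some i_m; m > k is excluded by the
-- order condition and m < k by induction on k, so j_k is matched to i_k.
module Submission where

open import Defs
open import Data.Nat using (ℕ; zero; suc; z<s; s<s)
open import Data.Fin using (Fin; zero; suc; _<_)
open import Data.Fin.Properties using (<-cmp; <-irrefl; <-asym; any?; _≟_)
open import Data.Fin.Induction using (<-wellFounded)
open import Induction.WellFounded using (module All)
open import Level using (0ℓ)
open import Data.Product using (_×_; _,_; proj₁; proj₂; ∃-syntax; swap)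
open import Data.Sum using (_⊎_; inj₁; inj₂; [_,_])
open import Data.Empty using (⊥-elim)
open import Relation.Nullary using (¬_; yes; no)
open import Relation.Unary using (_≐_)
open import Relation.Binary using (tri<; tri≈; tri>)
open import Relation.Binary.PropositionalEquality
  using (_≡_; refl; sym; trans; cong; subst; subst₂)
open import Function using (id; _∘_)
open import Function.Bundles using (_⇔_; mk⇔; Equivalence)
open import Function.Definitions using (Injective)
open import Function.Properties.Equivalence using () renaming (trans to ⇔-trans)

BlackBefore : ∀ {n t} → Black n → (Fin t → Fin n) → Fin t → Black n
BlackBefore B i k w = B w ⊎ ∃[ m ] (m < k × w ≡ i m)

Covers : ∀ {n t} → Black n → (Fin t → Fin n) → Set
Covers B i = ∀ w → B w ⊎ ∃[ m ] w ≡ i m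

ForcesInTurn : ∀ {n t} → LoopDigraph n → Black n → (Fin t → Fin n) → (Fin t → Fin n) → Set
ForcesInTurn G B i j = ∀ k → Forces G (BlackBefore B i k) (j k) (i k)

forces-resp-≐ : ∀ {n} (G : LoopDigraph n) {B B′ : Black n} {u v : Fin n} →
  B ≐ B′ → Forces G B u v → Forces G B′ u v
forces-resp-≐ G (B⊆B′ , B′⊆B) (v-white , arc , unique) =
  v-white ∘ B′⊆B , arc , λ w arc-w w-white → unique w arc-w (w-white ∘ B⊆B′)

blackBefore-zero : ∀ {n t} {B : Black n} {i : Fin (suc t) → Fin n} →
  BlackBefore B i zero ≐ B
blackBefore-zero = [ id , (λ { (_ , () , _) }) ] , inj₁

blackBefore-suc : ∀ {n t} {B : Black n} {i : Fin (suc t) → Fin n} {k : Fin t} →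
  BlackBefore (addBlack B (i zero)) (i ∘ suc) k ≐ BlackBefore B i (suc k)
blackBefore-suc {B = B} {i} {k} = to , from
  where
  to : ∀ {w} → BlackBefore (addBlack B (i zero)) (i ∘ suc) k w → BlackBefore B i (suc k) w
  to (inj₁ (inj₁ b))         = inj₁ b
  to (inj₁ (inj₂ eq))        = inj₂ (zero , z<s , eq)
  to (inj₂ (m , m<k , eq))   = inj₂ (suc m , s<s m<k , eq)
  from : ∀ {w} → BlackBefore B i (suc k) w → BlackBefore (addBlack B (i zero)) (i ∘ suc) k w
  from (inj₁ b)                    = inj₁ (inj₁ b)
  from (inj₂ (zero , _ , eq))      = inj₁ (inj₂ eq)
  from (inj₂ (suc m , s<s m<k , eq)) = inj₂ (m , m<k , eq)

covers-suc : ∀ {n t} {B : Black n} {i : Fin (suc t) → Fin n} →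
  Covers B i → Covers (addBlack B (i zero)) (i ∘ suc)
covers-suc cover w with cover w
... | inj₁ b              = inj₁ (inj₁ b)
... | inj₂ (zero , eq)    = inj₁ (inj₂ eq)
... | inj₂ (suc m , eq)   = inj₂ (m , eq)

chronList⇒forcesInTurn : ∀ {n t} (G : LoopDigraph n) {B : Black n} (i j : Fin t → Fin n) →
  ChronList G B (forceList i j) → ForcesInTurn G B i j
chronList⇒forcesInTurn G i j (first , _) zero = forces-resp-≐ G (swap blackBefore-zero) first
chronList⇒forcesInTurn G i j (_ , rest) (suc k) =
  forces-resp-≐ G blackBefore-suc (chronList⇒forcesInTurn G (i ∘ suc) (j ∘ suc) rest k)

forcesInTurn⇒chronList : ∀ {n t} (G : LoopDigraph n) {B : Black n} (i j : Fin t → Fin n) →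
  Covers B i → ForcesInTurn G B i j → ChronList G B (forceList i j)
forcesInTurn⇒chronList {t = zero} G i j cover _ w with cover w
... | inj₁ b = b
... | inj₂ (() , _)
forcesInTurn⇒chronList {t = suc t} G i j cover forces =
  forces-resp-≐ G blackBefore-zero (forces zero) ,
  forcesInTurn⇒chronList G (i ∘ suc) (j ∘ suc) (covers-suc cover)
    (λ k → forces-resp-≐ G (swap blackBefore-suc) (forces (suc k)))

chronList⇔forcesInTurn : ∀ {n t} (G : LoopDigraph n) {B : Black n} (i j : Fin t → Fin n) →
  Covers B i → ChronList G B (forceList i j) ⇔ ForcesInTurn G B i j
chronList⇔forcesInTurn G i j cover =
  mk⇔ (chronList⇒forcesInTurn G i j) (forcesInTurn⇒chronList G i j cover)

complement-covers : ∀ {n t} (i : Fin t → Fin n) → Covers (complementOf i) i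
complement-covers i w with any? (λ m → w ≟ i m)
... | yes hit = inj₂ hit
... | no miss = inj₁ (λ m eq → miss (m , eq))

complement-white : ∀ {n t} {i : Fin t → Fin n} {k m : Fin t} →
  Injective _≡_ _≡_ i → ¬ m < k → ¬ BlackBefore (complementOf i) i k (i m)
complement-white _     _   (inj₁ outside)          = outside _ refl
complement-white inj-i m≮k (inj₂ (m′ , m′<k , eq)) = m≮k (subst (_< _) (sym (inj-i eq)) m′<k)

complement-white⇒later : ∀ {n t} {i : Fin t → Fin n} {k : Fin t} {w : Fin n} →
  ¬ BlackBefore (complementOf i) i k w → ∃[ m ] (¬ m < k × w ≡ i m)
complement-white⇒later {i = i} {w = w} w-white with complement-covers i w
... | inj₁ outside  = ⊥-elim (w-white (inj₁ outside))
... | inj₂ (m , eq) = m , (λ m<k → w-white (inj₂ (m , m<k , eq))) , eq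

OrderedEdges : ∀ {n} → LoopDigraph n → (t : ℕ) → (Fin t → Fin n) → (Fin t → Fin n) → Set
OrderedEdges G t i j = (∀ k → BEdge G (i k) (j k)) × Injective _≡_ _≡_ i × OrderCondition G t i j

complementForcesInTurn⇒orderedEdges : ∀ {n t} (G : LoopDigraph n) (i j : Fin t → Fin n) →
  ForcesInTurn G (complementOf i) i j → OrderedEdges G t i j
complementForcesInTurn⇒orderedEdges G i j forces = edges , inj-i , order
  where
  edges : ∀ k → BEdge G (i k) (j k)
  edges k = proj₁ (proj₂ (forces k))
  inj-i : Injective _≡_ _≡_ i
  inj-i {k} {l} eq with <-cmp k l
  ... | tri< k<l _ _ = ⊥-elim (proj₁ (forces l) (inj₂ (k , k<l , sym eq)))
  ... | tri≈ _ k≡l _ = k≡l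
  ... | tri> _ _ l<k = ⊥-elim (proj₁ (forces k) (inj₂ (l , l<k , eq)))
  order : OrderCondition G _ i j
  order k l l<k arc = <-irrefl (sym (inj-i (proj₂ (proj₂ (forces l)) (i k) arc i-k-white))) l<k
    where
    i-k-white : ¬ BlackBefore (complementOf i) i l (i k)
    i-k-white = complement-white inj-i (<-asym l<k)

orderedEdges⇒complementForcesInTurn : ∀ {n t} (G : LoopDigraph n) (i j : Fin t → Fin n) →
  OrderedEdges G t i j → ForcesInTurn G (complementOf i) i j
orderedEdges⇒complementForcesInTurn G i j (edges , inj-i , order) k =
  complement-white inj-i (<-irrefl refl) , edges k , unique
  where
  unique : ∀ w → Arc G (j k) w → ¬ BlackBefore (complementOf i) i k w → w ≡ i k
  unique w arc w-white with complement-white⇒later w-white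
  ... | m , m≮k , refl with <-cmp m k
  ...   | tri< m<k _ _ = ⊥-elim (m≮k m<k)
  ...   | tri≈ _ m≡k _ = cong i m≡k
  ...   | tri> _ _ k<m = ⊥-elim (order m k k<m arc)

complementForcesInTurn⇔orderedEdges : ∀ {n t} (G : LoopDigraph n) (i j : Fin t → Fin n) →
  ForcesInTurn G (complementOf i) i j ⇔ OrderedEdges G t i j
complementForcesInTurn⇔orderedEdges G i j =
  mk⇔ (complementForcesInTurn⇒orderedEdges G i j) (orderedEdges⇒complementForcesInTurn G i j)

orderCondition⇒injective : ∀ {n t} (G : LoopDigraph n) (i j : Fin t → Fin n) →
  (∀ k → BEdge G (i k) (j k)) → OrderCondition G t i j → Injective _≡_ _≡_ j
orderCondition⇒injective G i j edges order {k} {l} eq with <-cmp k l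
... | tri< k<l _ _ = ⊥-elim (order l k k<l (subst (BEdge G (i l)) (sym eq) (edges l)))
... | tri≈ _ k≡l _ = k≡l
... | tri> _ _ l<k = ⊥-elim (order k l l<k (subst (BEdge G (i k)) eq (edges k)))

orderCondition⇒edgesIncluded : ∀ {n t} (G : LoopDigraph n) (i j i′ j′ : Fin t → Fin n) →
  Injective _≡_ _≡_ j → OrderCondition G t i j → IsMatching G t i′ j′ →
  SameMatchedVertices i j i′ j′ → ∀ k → ∃[ l ] (i k ≡ i′ l × j k ≡ j′ l)
orderCondition⇒edgesIncluded G i j i′ j′ inj-j order (edges′ , inj-i′ , _) (same-i , same-j) =
  All.wfRec <-wellFounded 0ℓ Included step
  where
  Included : Fin _ → Set
  Included k = ∃[ l ] (i k ≡ i′ l × j k ≡ j′ l)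
  step : ∀ k → (∀ {m} → m < k → Included m) → Included k
  step k earlier with Equivalence.to (same-j (j k)) (k , refl)
  ... | l , j′l≡jk with Equivalence.from (same-i (i′ l)) (l , refl)
  ...   | m , im≡i′l with <-cmp m k
  ...     | tri≈ _ m≡k _ = l , trans (cong i (sym m≡k)) im≡i′l , sym j′l≡jk
  ...     | tri> _ _ k<m = ⊥-elim (order m k k<m (subst₂ (BEdge G) (sym im≡i′l) j′l≡jk (edges′ l)))
  ...     | tri< m<k _ _ with earlier m<k
  ...       | l₀ , im≡i′l₀ , jm≡j′l₀ with inj-i′ (trans (sym im≡i′l₀) im≡i′l)
  ...         | refl = ⊥-elim (<-irrefl (inj-j (trans jm≡j′l₀ j′l≡jk)) m<k)

edgesIncluded⇒sameEdges : ∀ {n t} {i j i′ j′ : Fin t → Fin n} →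
  Injective _≡_ _≡_ i′ → (∀ l → ∃[ k ] i k ≡ i′ l) →
  (∀ k → ∃[ l ] (i k ≡ i′ l × j k ≡ j′ l)) → SameEdges i j i′ j′
edgesIncluded⇒sameEdges {i = i} {j} {i′} {j′} inj-i′ i′⊆i included = included , reverse
  where
  reverse : ∀ l → ∃[ k ] (i k ≡ i′ l × j k ≡ j′ l)
  reverse l with i′⊆i l
  ... | k , ik≡i′l with included k
  ...   | l′ , ik≡i′l′ , jk≡j′l′ with inj-i′ (trans (sym ik≡i′l′) ik≡i′l)
  ...     | refl = k , ik≡i′l′ , jk≡j′l′

orderCondition⇒constrained : ∀ {n t} (G : LoopDigraph n) (i j : Fin t → Fin n) →
  IsMatching G t i j → OrderCondition G t i j → IsConstrainedMatching G t i j
orderCondition⇒constrained G i j matching@(_ , _ , inj-j) order =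
  matching , λ i′ j′ matching′@(_ , inj-i′ , _) same@(same-i , _) →
    edgesIncluded⇒sameEdges inj-i′ (λ l → Equivalence.from (same-i (i′ l)) (l , refl))
      (orderCondition⇒edgesIncluded G i j i′ j′ inj-j order matching′ same)

orderedEdges⇔constrainedOrdered : ∀ {n t} (G : LoopDigraph n) (i j : Fin t → Fin n) →
  OrderedEdges G t i j ⇔ (IsConstrainedMatching G t i j × OrderCondition G t i j)
orderedEdges⇔constrainedOrdered G i j = mk⇔
  (λ (edges , inj-i , order) →
    orderCondition⇒constrained G i j (edges , inj-i , orderCondition⇒injective G i j edges order) order , order)
  (λ (((edges , inj-i , _) , _) , order) → edges , inj-i , order)

theorem5p4 : ∀ {n} (G : LoopDigraph n) (t : ℕ) (i j : Fin t → Fin n) →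
    IsZFSWithChronList G (complementOf i) (forceList i j)
      ⇔ (IsConstrainedMatching G t i j × OrderCondition G t i j)
theorem5p4 G t i j =
  ⇔-trans (chronList⇔forcesInTurn G i j (complement-covers i))
    (⇔-trans (complementForcesInTurn⇔orderedEdges G i j) (orderedEdges⇔constrainedOrdered G i j))
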